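{- Let $r \geq 1$ be an integer and let $b > 1$ be an odd integer such that $M = 2^r b^2$ is almost perfect. Define the integer $c$ by $\sigma(b^2) = 2b^2 - c$. Then $$c \geq \frac{2b^2 + 1}{3}.$$
   Context: $\sigma(x)$ denotes the sum of the positive divisors of $x$. A positive integer $y$ is almost perfect if $\sigma(y) = 2y - 1$. -}

module Defs where

open import Data.Nat using (ℕ; suc; _+_; _*_)
open import Data.Nat.Divisibility using (_∣?_)
open import Data.List using (List; filter; upTo; map)
open import Data.Nat.ListAction using (sum)

-- σ n = sum of the positive divisors of n, i.e. of all d ∈ {1,…,n} with d ∣ n.
-- (σ 0 = 0 by this definition; only positive arguments are used.)
σ : ℕ → ℕ
σ n = sum (filter (_∣? n) (map suc (upTo n)))

-- y is almost perfect: σ(y) = 2y - 1, written without truncated subtraction.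
AlmostPerfect : ℕ → Set
AlmostPerfect y = σ y + 1 ≡ 2 * y
  where open import Relation.Binary.PropositionalEquality using (_≡_)

module Submission where

-- Write B = b², s = σ(B) and D = 2^(r+1).  The proof never factors σ; it only
-- compares divisor sums.  If n is odd and divides N > 0, the divisors of 2N
-- contain the doubles 2d of the divisors d of N and, among the odd numbers, all
-- divisors of n; hence σ(n) + 2σ(N) ≤ σ(2N).  Iterating this along N = 2^k n gives
-- 2^(k+1)·σ(n) ≤ σ(2^k n) + σ(n), i.e. σ(2^k n) ≥ (2^(k+1) − 1)·σ(n).  For
-- M = 2^r B almost perfect (σ(M) + 1 = 2M) this yields D·s + 1 ≤ D·B + s, and
-- since D ≥ 4 a linear argument gives 3s + 1 ≤ 4B.  As c = 2B − s, this is
-- exactly 2B + 1 ≤ 3c.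

open import Defs
open import Data.Nat using (ℕ; _≤_; _<_; _^_; _*_)
open import Data.Nat.DivMod using (_%_)
open import Data.Integer using (ℤ; +_; _-_) renaming (_*_ to _*ℤ_; _+_ to _+ℤ_; _≤_ to _≤ℤ_)
open import Relation.Binary.PropositionalEquality using (_≡_)

open import Data.Nat using (zero; suc; _+_; _∸_; _≤?_; z≤n; s≤s)
open import Data.Nat.Properties
open import Data.Nat.DivMod using (%-distribˡ-*)
open import Data.Nat.Divisibility
  using (_∣_; _∣?_; divides; ∣-trans; *-cancelˡ-∣; *-monoʳ-∣; n∣m⇒m%n≡0; n∣m*n)
open import Data.List using (filter; map; applyUpTo)
open import Data.Nat.ListAction using (sum)
open import Data.Empty using (⊥-elim)
open import Relation.Nullary using (yes; no; ¬_)
open import Relation.Binary.PropositionalEquality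
  using (refl; sym; trans; cong; cong₂; subst; module ≡-Reasoning)
open import Data.Nat.Tactic.RingSolver using (solve-∀)
open import Data.Integer using (_⊖_; +≤+)
import Data.Integer.Properties as ℤ
import Data.Integer.Tactic.RingSolver as ℤSolver

Σ< : ℕ → (ℕ → ℕ) → ℕ
Σ< zero    f = 0
Σ< (suc n) f = f 0 + Σ< n (λ i → f (suc i))

Σ<-cong : ∀ n {f g : ℕ → ℕ} → (∀ i → f i ≡ g i) → Σ< n f ≡ Σ< n g
Σ<-cong zero    f≡g = refl
Σ<-cong (suc n) f≡g = cong₂ _+_ (f≡g 0) (Σ<-cong n (λ i → f≡g (suc i)))

Σ<-mono : ∀ n {f g : ℕ → ℕ} → (∀ i → f i ≤ g i) → Σ< n f ≤ Σ< n g
Σ<-mono zero    f≤g = z≤n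
Σ<-mono (suc n) f≤g = +-mono-≤ (f≤g 0) (Σ<-mono n (λ i → f≤g (suc i)))

Σ<-+ : ∀ n (f g : ℕ → ℕ) → Σ< n (λ i → f i + g i) ≡ Σ< n f + Σ< n g
Σ<-+ zero    f g = refl
Σ<-+ (suc n) f g = begin
  f 0 + g 0 + Σ< n (λ i → f (suc i) + g (suc i))
    ≡⟨ cong (_+_ (f 0 + g 0)) (Σ<-+ n (λ i → f (suc i)) (λ i → g (suc i))) ⟩
  f 0 + g 0 + (Σ< n (λ i → f (suc i)) + Σ< n (λ i → g (suc i)))
    ≡⟨ interchange (f 0) (g 0) _ _ ⟩
  f 0 + Σ< n (λ i → f (suc i)) + (g 0 + Σ< n (λ i → g (suc i))) ∎
  where
  open ≡-Reasoning
  interchange : ∀ a b x y → a + b + (x + y) ≡ a + x + (b + y)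
  interchange = solve-∀

Σ<-scale : ∀ n k (f : ℕ → ℕ) → Σ< n (λ i → k * f i) ≡ k * Σ< n f
Σ<-scale zero    k f = sym (*-zeroʳ k)
Σ<-scale (suc n) k f =
  trans (cong (_+_ (k * f 0)) (Σ<-scale n k (λ i → f (suc i))))
        (sym (*-distribˡ-+ k (f 0) _))

Σ<-extend : ∀ {n m} (f : ℕ → ℕ) → n ≤ m → Σ< n f ≤ Σ< m f
Σ<-extend {zero}          f _         = z≤n
Σ<-extend {suc n} {suc m} f (s≤s n≤m) =
  +-monoʳ-≤ (f 0) (Σ<-extend (λ i → f (suc i)) n≤m)

Σ<-pairs : ∀ N (f : ℕ → ℕ) → Σ< (2 * N) f ≡ Σ< N (λ e → f (2 * e) + f (suc (2 * e)))
Σ<-pairs zero    f = refl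
Σ<-pairs (suc N) f = begin
  Σ< (2 * suc N) f
    ≡⟨ cong (λ m → Σ< m f) (*-suc 2 N) ⟩
  f 0 + (f 1 + Σ< (2 * N) (λ i → f (2 + i)))
    ≡⟨ sym (+-assoc (f 0) (f 1) _) ⟩
  f 0 + f 1 + Σ< (2 * N) (λ i → f (2 + i))
    ≡⟨ cong (_+_ (f 0 + f 1)) (Σ<-pairs N (λ i → f (2 + i))) ⟩
  f 0 + f 1 + Σ< N (λ e → f (2 + 2 * e) + f (suc (2 + 2 * e)))
    ≡⟨ cong (_+_ (f 0 + f 1)) (Σ<-cong N (λ e → cong (λ m → f m + f (suc m)) (sym (*-suc 2 e)))) ⟩
  f 0 + f 1 + Σ< N (λ e → f (2 * suc e) + f (suc (2 * suc e))) ∎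
  where open ≡-Reasoning

contribution : ℕ → ℕ → ℕ
contribution N d with d ∣? N
... | yes _ = d
... | no  _ = 0

sum-divisors : ∀ N (h g : ℕ → ℕ) n →
  sum (filter (_∣? N) (map h (applyUpTo g n))) ≡ Σ< n (λ i → contribution N (h (g i)))
sum-divisors N h g zero    = refl
sum-divisors N h g (suc n) with h (g 0) ∣? N
... | yes _ = cong (_+_ (h (g 0))) (sum-divisors N h (λ i → g (suc i)) n)
... | no  _ = sum-divisors N h (λ i → g (suc i)) n

σ-as-Σ< : ∀ N → σ N ≡ Σ< N (λ i → contribution N (suc i))
σ-as-Σ< N = sum-divisors N suc (λ i → i) N

contribution-double : ∀ N d → contribution (2 * N) (2 * d) ≡ 2 * contribution N d
contribution-double N d with 2 * d ∣? 2 * N | d ∣? N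
... | yes _     | yes _   = refl
... | yes 2d∣2N | no  d∤N = ⊥-elim (d∤N (*-cancelˡ-∣ 2 2d∣2N))
... | no  2d∤2N | yes d∣N = ⊥-elim (2d∤2N (*-monoʳ-∣ 2 d∣N))
... | no  _     | no  _   = refl

contribution-mono : ∀ {n M} d → n ∣ M → contribution n d ≤ contribution M d
contribution-mono {n} {M} d n∣M with d ∣? n | d ∣? M
... | yes _   | yes _   = ≤-refl
... | yes d∣n | no  d∤M = ⊥-elim (d∤M (∣-trans d∣n n∣M))
... | no  _   | _       = z≤n

contribution-even : ∀ {n} d → n % 2 ≡ 1 → 2 ∣ d → contribution n d ≡ 0
contribution-even {n} d odd 2∣d with d ∣? n
... | no  _   = refl
... | yes d∣n = ⊥-elim (1≢0 (trans (sym odd) (n∣m⇒m%n≡0 n 2 (∣-trans 2∣d d∣n))))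
  where
  1≢0 : ¬ (1 ≡ 0)
  1≢0 ()

-- Doubling bound: if n is odd and divides N ≥ n (i.e. N > 0), then the divisors of 2N include
-- the doubles of the divisors of N (the even ones) and the divisors of n (which
-- are odd), so σ(n) + 2σ(N) ≤ σ(2N).
σ-double : ∀ {n N} → n % 2 ≡ 1 → n ∣ N → n ≤ N → σ n + 2 * σ N ≤ σ (2 * N)
σ-double {n} {N} odd n∣N n≤N = begin
  σ n + 2 * σ N                 ≤⟨ +-monoˡ-≤ (2 * σ N) σn≤oddPart ⟩
  Σ< N oddPart + 2 * σ N        ≡⟨ cong (_+_ (Σ< N oddPart)) (sym evenPart≡2σN) ⟩
  Σ< N oddPart + Σ< N evenPart  ≡⟨ sym σ2N-split ⟩
  σ (2 * N)                     ∎
  where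
  open ≤-Reasoning
  oddPart evenPart : ℕ → ℕ
  oddPart  e = contribution (2 * N) (suc (2 * e))
  evenPart e = contribution (2 * N) (suc (suc (2 * e)))

  σ2N-split : σ (2 * N) ≡ Σ< N oddPart + Σ< N evenPart
  σ2N-split = trans (σ-as-Σ< (2 * N))
                    (trans (Σ<-pairs N (λ i → contribution (2 * N) (suc i)))
                           (Σ<-+ N oddPart evenPart))

  evenPart≡2σN : Σ< N evenPart ≡ 2 * σ N
  evenPart≡2σN = begin-equality
    Σ< N evenPart
      ≡⟨ Σ<-cong N (λ e → trans (cong (contribution (2 * N)) (sym (*-suc 2 e)))
                                (contribution-double N (suc e))) ⟩
    Σ< N (λ e → 2 * contribution N (suc e))
      ≡⟨ Σ<-scale N 2 (λ e → contribution N (suc e)) ⟩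
    2 * Σ< N (λ e → contribution N (suc e))
      ≡⟨ cong (2 *_) (sym (σ-as-Σ< N)) ⟩
    2 * σ N ∎

  n∣2N : n ∣ 2 * N
  n∣2N = ∣-trans n∣N (n∣m*n 2)

  even : ∀ e → 2 ∣ suc (suc (2 * e))
  even e = divides (suc e) (trans (sym (*-suc 2 e)) (*-comm 2 (suc e)))

  pairBound : ∀ e → contribution n (suc (2 * e)) + contribution n (suc (suc (2 * e))) ≤ oddPart e
  pairBound e = begin
    contribution n (suc (2 * e)) + contribution n (suc (suc (2 * e)))
      ≡⟨ cong (_+_ (contribution n (suc (2 * e))))
              (contribution-even (suc (suc (2 * e))) odd (even e)) ⟩
    contribution n (suc (2 * e)) + 0
      ≡⟨ +-identityʳ _ ⟩
    contribution n (suc (2 * e))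
      ≤⟨ contribution-mono (suc (2 * e)) n∣2N ⟩
    oddPart e ∎

  σn≤oddPart : σ n ≤ Σ< N oddPart
  σn≤oddPart = begin
    σ n
      ≡⟨ σ-as-Σ< n ⟩
    Σ< n (λ i → contribution n (suc i))
      ≤⟨ Σ<-extend (λ i → contribution n (suc i)) (≤-trans n≤N (m≤n*m N 2)) ⟩
    Σ< (2 * N) (λ i → contribution n (suc i))
      ≡⟨ Σ<-pairs N (λ i → contribution n (suc i)) ⟩
    Σ< N (λ e → contribution n (suc (2 * e)) + contribution n (suc (suc (2 * e))))
      ≤⟨ Σ<-mono N pairBound ⟩
    Σ< N oddPart ∎

-- Iterating the doubling bound along 2^k n: σ(2^k n) ≥ (2^(k+1) − 1)·σ(n) for odd n,
-- stated without subtraction.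
σ-power-of-two : ∀ n k → n % 2 ≡ 1 → 2 ^ suc k * σ n ≤ σ (2 ^ k * n) + σ n
σ-power-of-two n zero    odd rewrite *-identityˡ n | +-identityʳ (σ n) = ≤-refl
σ-power-of-two n (suc k) odd = begin
  2 ^ suc (suc k) * σ n    ≡⟨ *-assoc 2 (2 ^ suc k) (σ n) ⟩
  2 * (2 ^ suc k * σ n)    ≤⟨ *-monoʳ-≤ 2 (σ-power-of-two n k odd) ⟩
  2 * (σ N + σ n)          ≡⟨ regroup (σ N) (σ n) ⟩
  σ n + 2 * σ N + σ n      ≤⟨ +-monoˡ-≤ (σ n) (σ-double odd (n∣m*n (2 ^ k)) n≤N) ⟩
  σ (2 * N) + σ n          ≡⟨ cong (λ m → σ m + σ n) (sym (*-assoc 2 (2 ^ k) n)) ⟩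
  σ (2 ^ suc k * n) + σ n  ∎
  where
  open ≤-Reasoning
  N = 2 ^ k * n
  n≤N : n ≤ N
  n≤N = m≤n*m n (2 ^ k) {{m^n≢0 2 k}}
  regroup : ∀ x y → 2 * (x + y) ≡ y + 2 * x + y
  regroup = solve-∀

almost-perfect-bound : ∀ k n → n % 2 ≡ 1 → AlmostPerfect (2 ^ k * n) →
                       2 ^ suc k * σ n + 1 ≤ 2 ^ suc k * n + σ n
almost-perfect-bound k n odd almostPerfect = begin
  2 ^ suc k * σ n + 1      ≤⟨ +-monoˡ-≤ 1 (σ-power-of-two n k odd) ⟩
  σ M + σ n + 1            ≡⟨ move-one (σ M) (σ n) ⟩
  σ M + 1 + σ n            ≡⟨ cong (_+ σ n) almostPerfect ⟩
  2 * M + σ n              ≡⟨ cong (_+ σ n) (sym (*-assoc 2 (2 ^ k) n)) ⟩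
  2 ^ suc k * n + σ n      ∎
  where
  open ≤-Reasoning
  M = 2 ^ k * n
  move-one : ∀ x y → x + y + 1 ≡ x + 1 + y
  move-one = solve-∀

-- Linear step: if D ≥ 4 and D·s + 1 ≤ D·B + s, then 3s + 1 ≤ 4B.  Otherwise
-- 4B ≤ 3s, and then 4(Ds + 1) ≤ D·4B + 4s ≤ 3Ds + 4s ≤ 4Ds, which is absurd.
linear-bound : ∀ D s B → 4 ≤ D → D * s + 1 ≤ D * B + s → 3 * s + 1 ≤ 4 * B
linear-bound D s B 4≤D bound with 4 * B ≤? 3 * s
... | no  4B≰3s = subst (_≤ 4 * B) (+-comm 1 (3 * s)) (≰⇒> 4B≰3s)
... | yes 4B≤3s = ⊥-elim (4≰0 (+-cancelˡ-≤ (4 * (D * s)) 4 0 chain))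
  where
  4≰0 : ¬ (4 ≤ 0)
  4≰0 ()
  open ≤-Reasoning
  chain : 4 * (D * s) + 4 ≤ 4 * (D * s) + 0
  chain = begin
    4 * (D * s) + 4         ≡⟨ *-distribˡ-+ 4 (D * s) 1 ⟨
    4 * (D * s + 1)         ≤⟨ *-monoʳ-≤ 4 bound ⟩
    4 * (D * B + s)         ≡⟨ expand D s B ⟩
    D * (4 * B) + 4 * s     ≤⟨ +-monoˡ-≤ (4 * s) (*-monoʳ-≤ D 4B≤3s) ⟩
    D * (3 * s) + 4 * s     ≤⟨ +-monoʳ-≤ (D * (3 * s)) (*-monoˡ-≤ s 4≤D) ⟩
    D * (3 * s) + D * s     ≡⟨ collect D s ⟩
    4 * (D * s) + 0         ∎
    where
    expand : ∀ D s B → 4 * (D * B + s) ≡ D * (4 * B) + 4 * s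
    expand = solve-∀
    collect : ∀ D s → D * (3 * s) + D * s ≡ 4 * (D * s) + 0
    collect = solve-∀

natural-difference : ∀ {m n} (c : ℤ) → n ≤ m → + n ≡ + m - c → c ≡ + (m ∸ n)
natural-difference {m} {n} c n≤m n≡m-c = begin
  c               ≡⟨ double-negation (+ m) c ⟩
  + m - (+ m - c) ≡⟨ cong (+ m -_) (sym n≡m-c) ⟩
  + m - + n       ≡⟨ ℤ.m-n≡m⊖n m n ⟩
  m ⊖ n           ≡⟨ ℤ.⊖-≥ n≤m ⟩
  + (m ∸ n)       ∎
  where
  open ≡-Reasoning
  double-negation : ∀ x y → y ≡ x - (x - y)
  double-negation = ℤSolver.solve-∀

deficiency-bound : ∀ s B (c : ℤ) → 3 * s + 1 ≤ 4 * B → + s ≡ + (2 * B) - c →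
                   + (2 * B) +ℤ + 1 ≤ℤ + 3 *ℤ c
deficiency-bound s B c bound s≡2B-c =
  subst (λ d → + (2 * B) +ℤ + 1 ≤ℤ + 3 *ℤ d) (sym (natural-difference c s≤2B s≡2B-c))
        (subst (+ (2 * B + 1) ≤ℤ_) (ℤ.pos-* 3 (2 * B ∸ s)) (+≤+ natural-bound))
  where
  s≤2B : s ≤ 2 * B
  s≤2B = *-cancelˡ-≤ 3 (begin
    3 * s          ≤⟨ m≤m+n (3 * s) 1 ⟩
    3 * s + 1      ≤⟨ bound ⟩
    4 * B          ≤⟨ *-monoˡ-≤ B {4} {6} (s≤s (s≤s (s≤s (s≤s z≤n)))) ⟩
    6 * B          ≡⟨ *-assoc 3 2 B ⟩
    3 * (2 * B)    ∎)
    where open ≤-Reasoning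

  natural-bound : 2 * B + 1 ≤ 3 * (2 * B ∸ s)
  natural-bound = subst (2 * B + 1 ≤_) (sym (*-distribˡ-∸ 3 (2 * B) s))
                        (m+n≤o⇒m≤o∸n (2 * B + 1) (begin
    2 * B + 1 + 3 * s    ≡⟨ regroup B s ⟩
    2 * B + (3 * s + 1)  ≤⟨ +-monoʳ-≤ (2 * B) bound ⟩
    2 * B + 4 * B        ≡⟨ regroup′ B ⟩
    3 * (2 * B)          ∎))
    where
    open ≤-Reasoning
    regroup : ∀ B s → 2 * B + 1 + 3 * s ≡ 2 * B + (3 * s + 1)
    regroup = solve-∀
    regroup′ : ∀ B → 2 * B + 4 * B ≡ 3 * (2 * B)
    regroup′ = solve-∀

odd-square : ∀ b → b % 2 ≡ 1 → (b * b) % 2 ≡ 1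
odd-square b odd = trans (%-distribˡ-* b b 2) (cong₂ (λ x y → (x * y) % 2) odd odd)

lemma2 : (r b : ℕ) → 1 ≤ r → 1 < b → b % 2 ≡ 1 →
         AlmostPerfect (2 ^ r * (b * b)) →
         (c : ℤ) → + σ (b * b) ≡ + (2 * (b * b)) - c →
         + (2 * (b * b)) +ℤ + 1 ≤ℤ + 3 *ℤ c
lemma2 zero    b ()
lemma2 (suc k) b _ _ odd almostPerfect c σB≡2B-c =
  deficiency-bound (σ B) B c
    (linear-bound (2 ^ suc (suc k)) (σ B) B 4≤D
      (almost-perfect-bound (suc k) B (odd-square b odd) almostPerfect))
    σB≡2B-c
  where
  B = b * b
  4≤D : 4 ≤ 2 ^ suc (suc k)
  4≤D = subst (4 ≤_) (*-assoc 2 2 (2 ^ k)) (*-monoʳ-≤ 4 (m^n>0 2 k))
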